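{- Let $G$ be a directed graph with $N$ nodes, let $d$ be a positive integer, let $k$ be a node of $G$ and let $W$ be a walk in $G$ containing node $k$. Then the $(d,k)$-reduction of $W$ satisfies \[ \ell\big(\mathrm{Red}_{d,k}(W)\big) \le (d-1) + 2d\,(N-1). \]
   Context: A walk is a finite sequence of consecutive edges with a start and end node (possibly empty); $\ell(W)$ is its number of edges, $\cdot$ denotes concatenation, a node of $W$ is the end node of some prefix of $W$. A cycle is a closed walk containing no nonempty closed walk as a proper subwalk. A cycle pattern of a walk $W$ is a finite, possibly empty, sequence $\mathcal{S}=(C_1,\dots,C_m)$ of nonempty cycles such that $W=U_0\cdot C_1\cdot U_1\cdots C_m\cdot U_m$ for some walks $U_0,\dots,U_m$ (one such decomposition being fixed by an arbitrary fixed choice function); then $\mathrm{Rem}(W,\mathcal{S})=U_0\cdot U_1\cdots U_m$ and $\ell(\mathcal{S})=\sum_r\ell(C_r)$. For a node $k$ of $W$, $\mathbf{S}_k(W)$ is the set of cycle patterns $\mathcal{S}$ of $W$ such that $k$ is a node of $\mathrm{Rem}(W,\mathcal{S})$, and $\mathbf{S}_{d,k}(W)$ the set of those $\mathcal{S}\in\mathbf{S}_k(W)$ with $\ell(\mathcal{S})\equiv 0\pmod d$ (it contains the empty pattern). $\mathrm{Step}_{d,k}(W)=\mathrm{Rem}(W,\mathcal{S})$ for some $\mathcal{S}\in\mathbf{S}_{d,k}(W)$ of maximal $\ell(\mathcal{S})$ (chosen by a fixed choice function), and $\mathrm{Red}_{d,k}(W)=\lim_{t\to\infty}\mathrm{Step}_{d,k}^t(W)$,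 the iterates being eventually stationary. -}

module Defs where

open import Data.Nat using (ℕ; zero; suc; _+_; _*_; _∸_; _≤_; _<_)
open import Data.Nat.Divisibility using (_∣_)
open import Data.Fin using (Fin)
open import Data.List using (List; []; _∷_; _++_; length; map)
open import Data.Nat.ListAction using (sum)
open import Data.List.Membership.Propositional using (_∈_)
open import Data.List.Relation.Unary.All using (All)
open import Data.Product using (Σ; ∃; ∃-syntax; _×_; _,_; proj₁; proj₂)
open import Data.Unit using (⊤)
open import Data.Empty using (⊥)
open import Relation.Binary.PropositionalEquality using (_≡_; _≢_)

-- Directed graphs on the node set Fin N, given by their edge relation
-- (E i j = "there is an edge from i to j").

Graph : ℕ → Set₁
Graph N = Fin N → Fin N → Set

-- A (raw) walk is its start node together with the list of the
-- end nodes of its successive edges; since edges of a directed graph are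
-- ordered pairs of nodes, this determines the edge sequence.

Walk : ℕ → Set
Walk N = Fin N × List (Fin N)

module _ {N : ℕ} where

  start : Walk N → Fin N
  start = proj₁

  len : Walk N → ℕ
  len W = length (proj₂ W)

  endFrom : Fin N → List (Fin N) → Fin N
  endFrom v []       = v
  endFrom v (x ∷ xs) = endFrom x xs

  end : Walk N → Fin N
  end (v , xs) = endFrom v xs

  ConsecEdges : Graph N → Fin N → List (Fin N) → Set
  ConsecEdges E v []       = ⊤
  ConsecEdges E v (x ∷ xs) = E v x × ConsecEdges E x xs

  IsWalk : Graph N → Walk N → Set
  IsWalk E (v , xs) = ConsecEdges E v xs

  -- concatenation U · V (meaningful when end U ≡ start V)
  _·_ : Walk N → Walk N → Walk N
  (v , xs) · (w , ys) = v , (xs ++ ys)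

  Consec : Walk N → Walk N → Set
  Consec U V = end U ≡ start V

  _∈ₙ_ : Fin N → Walk N → Set
  k ∈ₙ (v , xs) = k ∈ (v ∷ xs)

  Closed : Walk N → Set
  Closed W = start W ≡ end W

  Nonempty : Walk N → Set
  Nonempty W = 0 < len W

  IsSubwalk : Walk N → Walk N → Set
  IsSubwalk X W = ∃[ A ] ∃[ B ] (Consec A X × Consec X B × W ≡ (A · X) · B)

  IsCycle : Walk N → Set
  IsCycle C = Closed C ×
    ((X : Walk N) → IsSubwalk X C → X ≢ C → Closed X → Nonempty X → ⊥)

  -- Decompositions W = U₀ · C₁ · U₁ ⋯ Cₘ · Uₘ, stored as
  -- U₀ together with the list ((C₁ , U₁) , … , (Cₘ , Uₘ)).

  record Decomp : Set where
    constructor decomp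
    field
      U₀    : Walk N
      parts : List (Walk N × Walk N)

  open Decomp public

  wholeFrom : Walk N → List (Walk N × Walk N) → Walk N
  wholeFrom acc []             = acc
  wholeFrom acc ((C , U) ∷ ps) = wholeFrom ((acc · C) · U) ps

  remFrom : Walk N → List (Walk N × Walk N) → Walk N
  remFrom acc []             = acc
  remFrom acc ((C , U) ∷ ps) = remFrom (acc · U) ps

  ChainOK : Walk N → List (Walk N × Walk N) → Set
  ChainOK acc []             = ⊤
  ChainOK acc ((C , U) ∷ ps) =
    Consec acc C × Consec (acc · C) U × ChainOK ((acc · C) · U) ps

  whole : Decomp → Walk N
  whole D = wholeFrom (U₀ D) (parts D)

  remD : Decomp → Walk N
  remD D = remFrom (U₀ D) (parts D)

  cyclesOf : Decomp → List (Walk N)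
  cyclesOf D = map proj₁ (parts D)

  DecompOf : Decomp → List (Walk N) → Walk N → Set
  DecompOf D S W =
    ChainOK (U₀ D) (parts D) ×
    All (λ C → IsCycle C × Nonempty C) (cyclesOf D) ×
    cyclesOf D ≡ S × whole D ≡ W

  IsPattern : List (Walk N) → Walk N → Set
  IsPattern S W = ∃[ D ] DecompOf D S W

  lenP : List (Walk N) → ℕ
  lenP S = sum (map len S)

  -- The fixed (arbitrary) choice function for decompositions: for each
  -- pattern S of W it picks one decomposition; Rem(W,S) is its remainder.

  DecompChoice : Set
  DecompChoice = Walk N → List (Walk N) → Decomp

  IsDecompChoice : DecompChoice → Set
  IsDecompChoice dc = ∀ W S → IsPattern S W → DecompOf (dc W S) S W

  Rem : DecompChoice → Walk N → List (Walk N) → Walk N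
  Rem dc W S = remD (dc W S)

  InS : DecompChoice → ℕ → Fin N → Walk N → List (Walk N) → Set
  InS dc d k W S = IsPattern S W × k ∈ₙ Rem dc W S × d ∣ lenP S

  IsStepChoice : Graph N → ℕ → Fin N → DecompChoice →
                 (Walk N → List (Walk N)) → Set
  IsStepChoice E d k dc st =
    ∀ W → IsWalk E W → k ∈ₙ W →
      InS dc d k W (st W) × (∀ S → InS dc d k W S → lenP S ≤ lenP (st W))

  Step : DecompChoice → (Walk N → List (Walk N)) → Walk N → Walk N
  Step dc st W = Rem dc W (st W)

iter : {A : Set} → (A → A) → ℕ → A → A
iter f zero    x = x
iter f (suc t) x = f (iter f t x)

IsLimitOfIter : {A : Set} → (A → A) → A → A → Set
IsLimitOfIter f x R = ∃[ t₀ ] (∀ t → t₀ ≤ t → iter f t x ≡ R)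

-- Each step with a nonempty pattern shortens the walk, so the reduction stops at a walk R
-- through k whose only pattern in 𝐒_{d,k}(R) is empty. Suppose R were longer than the bound.
-- Cut R at an occurrence of k and, on each side, repeatedly split off the simple cycle closed
-- by the first repeated node; each cycle together with the gap before it has at most N edges.
-- Fewer than d cycles would keep R within the bound, so there are at least d of them; two of
-- the first d + 1 prefix sums of their lengths agree modulo d, and the cycles in between form a
-- nonempty pattern of length divisible by d whose removal keeps k, contradicting maximality.

module Submission where

open import Data.Bool using (Bool; true; false)
open import Data.Empty using (⊥; ⊥-elim)
open import Data.Fin using (Fin; toℕ) renaming (_≟_ to _≟ᶠ_)
import Data.Fin as Fin
open import Data.Fin.Properties using (pigeonhole; toℕ<n; toℕ-fromℕ<; toℕ≤pred[n])
open import Data.List using (List; []; _∷_; _++_; _∷ʳ_; [_]; length; map; lookup; take; drop; replicate)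
open import Data.List.Properties using (++-assoc; ++-identityʳ; length-++; ∷-injective; ∷ʳ-injective; take-[])
open import Data.List.Membership.Propositional using (_∈_; _∉_)
open import Data.List.Membership.Propositional.Properties using (∈-++⁺ˡ; ∈-++⁺ʳ; ∈-++⁻; ∈-∃++; ∈-lookup)
open import Data.List.Relation.Unary.All using (All; []; _∷_)
open import Data.List.Relation.Unary.Any using (here; there)
open import Data.Nat using (ℕ; zero; suc; _+_; _*_; _∸_; _≤_; _<_; z≤n; s≤s; NonZero)
open import Data.Nat.DivMod using (_%_; _/_; _mod_; m≡m%n+[m/n]*n)
open import Data.Nat.Divisibility using (_∣_; divides)
open import Data.Nat.ListAction using (sum)
open import Data.Nat.Properties
open import Data.Nat.Solver using (module +-*-Solver)
open import Data.Product using (∃-syntax; _×_; _,_; proj₁; proj₂)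
open import Data.Sum using (_⊎_; inj₁; inj₂)
open import Data.Unit using (⊤; tt)
open import Function using (_∘_)
open import Relation.Nullary using (¬_; yes; no)
open import Relation.Binary.PropositionalEquality hiding ([_])

open import Defs

-- Walks as node lists

module _ {N : ℕ} where

  endFrom-++ : ∀ (v : Fin N) xs ys → endFrom v (xs ++ ys) ≡ endFrom (endFrom v xs) ys
  endFrom-++ v []       ys = refl
  endFrom-++ v (x ∷ xs) ys = endFrom-++ x xs ys

  end-· : ∀ (P Q : Walk N) → end (P · Q) ≡ endFrom (end P) (proj₂ Q)
  end-· (v , xs) (w , ys) = endFrom-++ v xs ys

  endFrom-∈ : ∀ (v : Fin N) xs → endFrom v xs ∈ v ∷ xs
  endFrom-∈ v []       = here refl
  endFrom-∈ v (x ∷ xs) = there (endFrom-∈ x xs)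

  ∷≡∷ʳ-endFrom : ∀ (v : Fin N) xs → ∃[ ys ] (v ∷ xs ≡ ys ∷ʳ endFrom v xs)
  ∷≡∷ʳ-endFrom v []       = [] , refl
  ∷≡∷ʳ-endFrom v (x ∷ xs) with ys , eq ← ∷≡∷ʳ-endFrom x xs = v ∷ ys , cong (v ∷_) eq

  ConsecEdges-++⁻ : ∀ {E : Graph N} v xs ys → ConsecEdges E v (xs ++ ys) →
                    ConsecEdges E v xs × ConsecEdges E (endFrom v xs) ys
  ConsecEdges-++⁻ v []       ys c       = tt , c
  ConsecEdges-++⁻ v (x ∷ xs) ys (e , c) =
    let a , b = ConsecEdges-++⁻ x xs ys c in (e , a) , b

  ConsecEdges-++⁺ : ∀ {E : Graph N} v xs ys → ConsecEdges E v xs →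
                    ConsecEdges E (endFrom v xs) ys → ConsecEdges E v (xs ++ ys)
  ConsecEdges-++⁺ v []       ys _       c = c
  ConsecEdges-++⁺ v (x ∷ xs) ys (e , a) c = e , ConsecEdges-++⁺ x xs ys a c

  cycle-endFrom : ∀ {v : Fin N} {xs} → IsCycle (v , xs) → endFrom v xs ≡ v
  cycle-endFrom (closed , _) = sym closed

  -- Decompositions and their remainders

  wholeNodes : List (Walk N × Walk N) → List (Fin N)
  wholeNodes []             = []
  wholeNodes ((C , U) ∷ ps) = proj₂ C ++ (proj₂ U ++ wholeNodes ps)

  remNodes : List (Walk N × Walk N) → List (Fin N)
  remNodes []             = []
  remNodes ((C , U) ∷ ps) = proj₂ U ++ remNodes ps

  cycleNodes : List (Walk N) → List (Fin N)
  cycleNodes []      = []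
  cycleNodes (C ∷ S) = proj₂ C ++ cycleNodes S

  wholeFrom-nodes : ∀ acc ps → wholeFrom acc ps ≡ (proj₁ acc , proj₂ acc ++ wholeNodes ps)
  wholeFrom-nodes (a , as) []             = cong (a ,_) (sym (++-identityʳ as))
  wholeFrom-nodes (a , as) ((C , U) ∷ ps) = trans (wholeFrom-nodes ((a , as ++ proj₂ C) · U) ps)
    (cong (a ,_) (trans (++-assoc (as ++ proj₂ C) (proj₂ U) (wholeNodes ps))
                        (++-assoc as (proj₂ C) (proj₂ U ++ wholeNodes ps))))

  remFrom-nodes : ∀ acc ps → remFrom acc ps ≡ (proj₁ acc , proj₂ acc ++ remNodes ps)
  remFrom-nodes (a , as) []             = cong (a ,_) (sym (++-identityʳ as))
  remFrom-nodes (a , as) ((C , U) ∷ ps) =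
    trans (remFrom-nodes ((a , as) · U) ps) (cong (a ,_) (++-assoc as (proj₂ U) (remNodes ps)))

  Additive : (List (Fin N) → ℕ) → Set
  Additive f = ∀ xs ys → f (xs ++ ys) ≡ f xs + f ys

  module _ (f : List (Fin N) → ℕ) (f-++ : Additive f) where

    wholeNodes-additive : ∀ ps → f (wholeNodes ps) ≡ f (cycleNodes (map proj₁ ps)) + f (remNodes ps)
    wholeNodes-additive []             = f-++ [] []
    wholeNodes-additive ((C , U) ∷ ps) = begin
      f (c ++ (u ++ wholeNodes ps))                           ≡⟨ f-++ c _ ⟩
      f c + f (u ++ wholeNodes ps)                            ≡⟨ cong (f c +_) (f-++ u _) ⟩
      f c + (f u + f (wholeNodes ps))                         ≡⟨ cong (λ z → f c + (f u + z)) (wholeNodes-additive ps) ⟩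
      f c + (f u + (f (cycleNodes cs) + f (remNodes ps)))     ≡⟨ interchange (f c) (f u) _ _ ⟩
      (f c + f (cycleNodes cs)) + (f u + f (remNodes ps))     ≡⟨ sym (cong₂ _+_ (f-++ c _) (f-++ u _)) ⟩
      f (c ++ cycleNodes cs) + f (u ++ remNodes ps)           ∎
      where
        open ≡-Reasoning
        c = proj₂ C
        u = proj₂ U
        cs = map proj₁ ps
        interchange : ∀ a b x y → a + (b + (x + y)) ≡ (a + x) + (b + y)
        interchange = +-*-Solver.solve 4
          (λ a b x y → a :+ (b :+ (x :+ y)) := (a :+ x) :+ (b :+ y)) refl
          where open +-*-Solver

    DecompOf-additive : ∀ {D S W} → DecompOf D S W →
                        f (proj₂ W) ≡ f (proj₂ (remD D)) + f (cycleNodes S)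
    DecompOf-additive {decomp (u₀ , us) ps} {S} (_ , _ , refl , refl) = begin
      f (proj₂ (wholeFrom (u₀ , us) ps))                ≡⟨ cong (λ R → f (proj₂ R)) (wholeFrom-nodes (u₀ , us) ps) ⟩
      f (us ++ wholeNodes ps)                           ≡⟨ f-++ us _ ⟩
      f us + f (wholeNodes ps)                          ≡⟨ cong (f us +_) (wholeNodes-additive ps) ⟩
      f us + (f (cycleNodes S) + f (remNodes ps))       ≡⟨ cong (f us +_) (+-comm _ (f (remNodes ps))) ⟩
      f us + (f (remNodes ps) + f (cycleNodes S))       ≡⟨ sym (+-assoc (f us) _ _) ⟩
      f us + f (remNodes ps) + f (cycleNodes S)         ≡⟨ cong (_+ f (cycleNodes S)) (sym (f-++ us _)) ⟩
      f (us ++ remNodes ps) + f (cycleNodes S)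
        ≡⟨ cong (λ R → f (proj₂ R) + f (cycleNodes S)) (sym (remFrom-nodes (u₀ , us) ps)) ⟩
      f (proj₂ (remFrom (u₀ , us) ps)) + f (cycleNodes S) ∎
      where open ≡-Reasoning

  length-cycleNodes : ∀ S → length (cycleNodes S) ≡ lenP S
  length-cycleNodes []      = refl
  length-cycleNodes (C ∷ S) = trans (length-++ (proj₂ C)) (cong (len C +_) (length-cycleNodes S))

  len-DecompOf : ∀ {D S} {W : Walk N} → DecompOf D S W → len W ≡ len (remD D) + lenP S
  len-DecompOf {S = S} dec = trans (DecompOf-additive length (λ xs _ → length-++ xs) dec)
                                 (cong (_ +_) (length-cycleNodes S))

  start-remD : ∀ {D S} {W : Walk N} → DecompOf D S W → start (remD D) ≡ start W
  start-remD {decomp (u₀ , us) ps} (_ , _ , _ , refl) =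
    trans (cong proj₁ (remFrom-nodes (u₀ , us) ps)) (sym (cong proj₁ (wholeFrom-nodes (u₀ , us) ps)))

  count : Fin N → List (Fin N) → ℕ
  count k []       = 0
  count k (x ∷ xs) with k ≟ᶠ x
  ... | yes _ = suc (count k xs)
  ... | no  _ = count k xs

  count-++ : ∀ k → Additive (count k)
  count-++ k []       ys = refl
  count-++ k (x ∷ xs) ys with k ≟ᶠ x
  ... | yes _ = cong suc (count-++ k xs ys)
  ... | no  _ = count-++ k xs ys

  ∈⇒count>0 : ∀ {k xs} → k ∈ xs → 0 < count k xs
  ∈⇒count>0 {k} {x ∷ xs} k∈ with k ≟ᶠ x | k∈
  ... | yes _   | _          = s≤s z≤n
  ... | no  k≢x | here k≡x   = ⊥-elim (k≢x k≡x)
  ... | no  _   | there k∈xs = ∈⇒count>0 k∈xs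

  count>0⇒∈ : ∀ {k} xs → 0 < count k xs → k ∈ xs
  count>0⇒∈ {k} (x ∷ xs) c with k ≟ᶠ x
  ... | yes k≡x = here k≡x
  ... | no  _   = there (count>0⇒∈ xs c)

  nodeCount : Fin N → Walk N → ℕ
  nodeCount k W = count k (start W ∷ proj₂ W)

  nodeCount-DecompOf : ∀ k {D S W} → DecompOf D S W →
                       nodeCount k W ≡ nodeCount k (remD D) + count k (cycleNodes S)
  nodeCount-DecompOf k {D} {S} {W} dec = begin
    nodeCount k W
      ≡⟨ count-++ k [ start W ] (proj₂ W) ⟩
    count k [ start W ] + count k (proj₂ W)
      ≡⟨ cong (count k [ start W ] +_) (DecompOf-additive (count k) (count-++ k) dec) ⟩
    count k [ start W ] + (count k (proj₂ (remD D)) + count k (cycleNodes S))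
      ≡⟨ sym (+-assoc (count k [ start W ]) _ _) ⟩
    count k [ start W ] + count k (proj₂ (remD D)) + count k (cycleNodes S)
      ≡⟨ cong (λ v → count k [ v ] + count k (proj₂ (remD D)) + count k (cycleNodes S)) (sym (start-remD dec)) ⟩
    count k [ start (remD D) ] + count k (proj₂ (remD D)) + count k (cycleNodes S)
      ≡⟨ cong (_+ count k (cycleNodes S)) (sym (count-++ k [ start (remD D) ] (proj₂ (remD D)))) ⟩
    nodeCount k (remD D) + count k (cycleNodes S) ∎
    where open ≡-Reasoning

  -- Whether k survives in Rem(W, S) does not depend on the chosen decomposition:
  -- its number of occurrences there is its count in W minus its count in S.
  ∈ₙ-remD-irrelevant : ∀ {k D D′ S} {W : Walk N} → DecompOf D S W → DecompOf D′ S W →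
                       k ∈ₙ remD D → k ∈ₙ remD D′
  ∈ₙ-remD-irrelevant {k} {D} {D′} {S} dec dec′ k∈ =
    count>0⇒∈ (proj₁ (remD D′) ∷ proj₂ (remD D′)) (subst (0 <_) same-count (∈⇒count>0 k∈))
    where
      same-count : nodeCount k (remD D) ≡ nodeCount k (remD D′)
      same-count = +-cancelʳ-≡ _ _ _
        (trans (sym (nodeCount-DecompOf k dec)) (nodeCount-DecompOf k dec′))

  ConsecEdges-remNodes : ∀ {E : Graph N} acc ps → ChainOK acc ps →
    All (λ C → IsCycle C × Nonempty C) (map proj₁ ps) →
    ConsecEdges E (end acc) (wholeNodes ps) → ConsecEdges E (end acc) (remNodes ps)
  ConsecEdges-remNodes acc [] _ _ _ = tt
  ConsecEdges-remNodes {E} acc ((C , U) ∷ ps) (acc→C , _ , chain) ((cyc , _) ∷ cycs) edges =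
    ConsecEdges-++⁺ e (proj₂ U) (remNodes ps) edgesU
      (subst (λ v → ConsecEdges E v (remNodes ps)) end-acc′
        (ConsecEdges-remNodes acc′ ps chain cycs
          (subst (λ v → ConsecEdges E v (wholeNodes ps)) (sym end-acc′) edgesRest)))
    where
      e = end acc
      acc′ = (acc · C) · U
      C-returns : endFrom e (proj₂ C) ≡ e
      C-returns = subst (λ v → endFrom v (proj₂ C) ≡ v) (sym acc→C) (cycle-endFrom cyc)
      edgesAfterC : ConsecEdges E e (proj₂ U ++ wholeNodes ps)
      edgesAfterC = subst (λ v → ConsecEdges E v _) C-returns
        (proj₂ (ConsecEdges-++⁻ e (proj₂ C) _ edges))
      edgesU = proj₁ (ConsecEdges-++⁻ e (proj₂ U) (wholeNodes ps) edgesAfterC)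
      edgesRest = proj₂ (ConsecEdges-++⁻ e (proj₂ U) (wholeNodes ps) edgesAfterC)
      end-acc′ : end acc′ ≡ endFrom e (proj₂ U)
      end-acc′ = trans (end-· (acc · C) U)
        (cong (λ v → endFrom v (proj₂ U)) (trans (end-· acc C) C-returns))

  IsWalk-remD : ∀ {E : Graph N} {D S W} → DecompOf D S W → IsWalk E W → IsWalk E (remD D)
  IsWalk-remD {E} {decomp (u₀ , us) ps} (chain , cycs , _ , refl) walk =
    subst (IsWalk E) (sym (remFrom-nodes (u₀ , us) ps))
      (ConsecEdges-++⁺ u₀ us (remNodes ps) (proj₁ split)
        (ConsecEdges-remNodes (u₀ , us) ps chain cycs (proj₂ split)))
    where
      split = ConsecEdges-++⁻ u₀ us (wholeNodes ps)
                (subst (IsWalk E) (wholeFrom-nodes (u₀ , us) ps) walk)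

  lenP≡0⇒[] : ∀ (S : List (Walk N)) → All (λ C → IsCycle C × Nonempty C) S → lenP S ≡ 0 → S ≡ []
  lenP≡0⇒[] []      _                 _  = refl
  lenP≡0⇒[] (C ∷ S) ((_ , C≢[]) ∷ _) eq = ⊥-elim (<-irrefl (sym (m+n≡0⇒m≡0 (len C) eq)) C≢[])

  remD-null : ∀ {D S} {W : Walk N} → DecompOf D S W → lenP S ≡ 0 → remD D ≡ W
  remD-null {decomp u₀ []}      (_ , _ , _ , refl) _ = refl
  remD-null {decomp u₀ (_ ∷ _)} (_ , cycs , refl , _) eq with lenP≡0⇒[] _ cycs eq
  ... | ()

-- Iterating Step

iter-suc : ∀ {A : Set} (f : A → A) t x → iter f (suc t) x ≡ iter f t (f x)
iter-suc f zero    x = refl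
iter-suc f (suc t) x = cong f (iter-suc f t x)

iter-fixpoint : ∀ {A : Set} {f : A → A} {x} → f x ≡ x → ∀ t → iter f t x ≡ x
iter-fixpoint fx≡x zero    = refl
iter-fixpoint {f = f} fx≡x (suc t) = trans (cong f (iter-fixpoint fx≡x t)) fx≡x

iter-stabilises : ∀ {A : Set} (f : A → A) (P : A → Set) (μ : A → ℕ) →
  (∀ {x} → P x → P (f x)) → (∀ {x} → P x → f x ≡ x ⊎ μ (f x) < μ x) →
  ∀ {x} → P x → ∃[ r ] (IsLimitOfIter f x r × P r × f r ≡ r)
iter-stabilises f P μ preserve decrease {x} Px = go (μ x) ≤-refl Px
  where
    go : ∀ n {x} → μ x ≤ n → P x → ∃[ r ] (IsLimitOfIter f x r × P r × f r ≡ r)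
    go n {x} μx≤n Px with decrease Px
    ... | inj₁ fixed = x , (0 , λ t _ → iter-fixpoint fixed t) , Px , fixed
    go zero    μx≤0 Px | inj₂ shorter = ⊥-elim (n≮0 (<-≤-trans shorter μx≤0))
    go (suc n) {x} μx≤n Px | inj₂ shorter
      with r , (t₀ , limit) , Pr , fixed ← go n (≤-pred (<-≤-trans shorter μx≤n)) (preserve Px) =
      r , (suc t₀ , λ { (suc t) (s≤s t₀≤t) → trans (iter-suc f t x) (limit t t₀≤t) }) , Pr , fixed

module Reduction {N : ℕ} (E : Graph N) (d : ℕ) (k : Fin N)
    (dc : DecompChoice) (dc-ok : IsDecompChoice dc)
    (st : Walk N → List (Walk N)) (st-ok : IsStepChoice E d k dc st) where

  Admissible : Walk N → Set
  Admissible W = IsWalk E W × k ∈ₙ W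

  step-pattern : ∀ {W} → Admissible W → InS dc d k W (st W)
  step-pattern (walk , k∈) = proj₁ (st-ok _ walk k∈)

  step-decomp : ∀ {W} → Admissible W → DecompOf (dc W (st W)) (st W) W
  step-decomp a = dc-ok _ _ (proj₁ (step-pattern a))

  Step-admissible : ∀ {W} → Admissible W → Admissible (Step dc st W)
  Step-admissible a = IsWalk-remD (step-decomp a) (proj₁ a) , proj₁ (proj₂ (step-pattern a))

  Step-fixed-or-shorter : ∀ {W} → Admissible W → Step dc st W ≡ W ⊎ len (Step dc st W) < len W
  Step-fixed-or-shorter {W} a with lenP (st W) in eq
  ... | zero  = inj₁ (remD-null (step-decomp a) eq)
  ... | suc _ = inj₂ (subst (len (Step dc st W) <_)
                       (sym (trans (len-DecompOf (step-decomp a)) (cong (len (Step dc st W) +_) eq)))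
                       (m<m+n _ (s≤s z≤n)))

  Step-fixed⇒null : ∀ {W} → Admissible W → Step dc st W ≡ W → lenP (st W) ≡ 0
  Step-fixed⇒null {W} a fixed = +-cancelˡ-≡ (len W) _ _
    (trans (sym (trans (len-DecompOf (step-decomp a)) (cong (λ R → len R + _) fixed)))
           (sym (+-identityʳ (len W))))

  Red-exists : ∀ {W} → Admissible W →
    ∃[ R ] (IsLimitOfIter (Step dc st) W R × Admissible R × lenP (st R) ≡ 0)
  Red-exists a with R , limit , aR , fixed ← iter-stabilises (Step dc st) Admissible len
                                               Step-admissible Step-fixed-or-shorter a =
    R , limit , aR , Step-fixed⇒null aR fixed

-- Blocks of a list whose sum is divisible by d

selectedSum : List Bool → List ℕ → ℕ
selectedSum []          _        = 0
selectedSum (_     ∷ _) []       = 0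
selectedSum (true  ∷ m) (x ∷ xs) = x + selectedSum m xs
selectedSum (false ∷ m) (x ∷ xs) = selectedSum m xs

selectedSum-[] : ∀ m → selectedSum m [] ≡ 0
selectedSum-[] []      = refl
selectedSum-[] (_ ∷ _) = refl

selectedSum-skip : ∀ a m xs → selectedSum (replicate a false ++ m) xs ≡ selectedSum m (drop a xs)
selectedSum-skip zero    m xs       = refl
selectedSum-skip (suc a) m []       = sym (selectedSum-[] m)
selectedSum-skip (suc a) m (x ∷ xs) = selectedSum-skip a m xs

selectedSum-take : ∀ c xs → selectedSum (replicate c true) xs ≡ sum (take c xs)
selectedSum-take zero    xs       = refl
selectedSum-take (suc c) []       = refl
selectedSum-take (suc c) (x ∷ xs) = cong (x +_) (selectedSum-take c xs)

sum-take-+ : ∀ a c xs → sum (take (a + c) xs) ≡ sum (take a xs) + sum (take c (drop a xs))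
sum-take-+ zero    c xs       = refl
sum-take-+ (suc a) c []       = sym (cong sum (take-[] c))
sum-take-+ (suc a) c (x ∷ xs) = trans (cong (x +_) (sum-take-+ a c xs)) (sym (+-assoc x _ _))

sum-take-drop-positive : ∀ a c xs → 0 < c → a + c ≤ length xs → All (0 <_) xs →
                         0 < sum (take c (drop a xs))
sum-take-drop-positive zero    (suc c) (x ∷ xs) _   _          (x>0 ∷ _) = ≤-trans x>0 (m≤m+n x _)
sum-take-drop-positive (suc a) c       (x ∷ xs) c>0 (s≤s a+c≤) (_ ∷ xs>0) =
  sum-take-drop-positive a c xs c>0 a+c≤ xs>0

module _ (d : ℕ) .{{_ : NonZero d}} where

  %-≡⇒∣ : ∀ m n → m % d ≡ (m + n) % d → d ∣ n
  %-≡⇒∣ m n eq = divides ((m + n) / d ∸ m / d) (sym (trans (*-distribʳ-∸ d ((m + n) / d) (m / d)) (sym n≡)))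
    where
      open ≡-Reasoning
      n≡ : n ≡ (m + n) / d * d ∸ m / d * d
      n≡ = begin
        n                                                 ≡⟨ m+n∸m≡n m n ⟨
        (m + n) ∸ m                                       ≡⟨ cong₂ _∸_ (m≡m%n+[m/n]*n (m + n) d) (m≡m%n+[m/n]*n m d) ⟩
        ((m + n) % d + (m + n) / d * d) ∸ (m % d + m / d * d)
          ≡⟨ cong (λ r → ((m + n) % d + (m + n) / d * d) ∸ (r + m / d * d)) eq ⟩
        ((m + n) % d + (m + n) / d * d) ∸ ((m + n) % d + m / d * d) ≡⟨ [m+n]∸[m+o]≡n∸o ((m + n) % d) _ _ ⟩
        (m + n) / d * d ∸ m / d * d                       ∎

  -- Two of the d + 1 prefix sums 0, x₀, x₀ + x₁, … agree modulo d; take the block between them.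
  divisible-block : ∀ xs → d ≤ length xs → All (0 <_) xs →
                    ∃[ mask ] (d ∣ selectedSum mask xs × 0 < selectedSum mask xs)
  divisible-block xs d≤ xs>0 with i , j , i<j , same ← pigeonhole ≤-refl (λ (i : Fin (suc d)) → sum (take (toℕ i) xs) mod d) =
    replicate a false ++ replicate c true ,
    subst (d ∣_) (sym block) (%-≡⇒∣ _ _ same%) ,
    subst (0 <_) (sym block) (sum-take-drop-positive a c xs (m<n⇒0<n∸m i<j)
      (≤-trans (≤-reflexive a+c≡j) (≤-trans (toℕ≤pred[n] j) d≤)) xs>0)
    where
      a = toℕ i
      c = toℕ j ∸ toℕ i
      a+c≡j : a + c ≡ toℕ j
      a+c≡j = m+[n∸m]≡n (<⇒≤ i<j)
      block : selectedSum (replicate a false ++ replicate c true) xs ≡ sum (take c (drop a xs))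
      block = trans (selectedSum-skip a _ xs) (selectedSum-take c (drop a xs))
      same% : sum (take a xs) % d ≡ (sum (take a xs) + sum (take c (drop a xs))) % d
      same% = trans (sym (toℕ-fromℕ< _)) (trans (cong toℕ same) (trans (toℕ-fromℕ< _)
                (trans (cong (λ t → sum (take t xs) % d) (sym a+c≡j)) (cong (_% d) (sum-take-+ a c xs)))))

-- Walks cut into marked pieces

-- A segmentation of a node list, `true` marking the pieces that are cycles of the pattern.
Piece : ℕ → Set
Piece N = Bool × List (Fin N)

module _ {N : ℕ} where

  pieceNodes : List (Piece N) → List (Fin N)
  pieceNodes []            = []
  pieceNodes ((_ , l) ∷ P) = l ++ pieceNodes P

  gapNodes : List (Piece N) → List (Fin N)
  gapNodes []                = []
  gapNodes ((false , l) ∷ P) = l ++ gapNodes P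
  gapNodes ((true  , l) ∷ P) = gapNodes P

  cycleLengths : List (Piece N) → List ℕ
  cycleLengths []                = []
  cycleLengths ((false , l) ∷ P) = cycleLengths P
  cycleLengths ((true  , l) ∷ P) = length l ∷ cycleLengths P

  CyclePieces : Fin N → List (Piece N) → Set
  CyclePieces v []                = ⊤
  CyclePieces v ((false , l) ∷ P) = CyclePieces (endFrom v l) P
  CyclePieces v ((true  , l) ∷ P) = (IsCycle (v , l) × Nonempty (v , l)) × CyclePieces (endFrom v l) P

  toDecomp : Walk N → List (Piece N) → Decomp
  toDecomp acc []                = decomp acc []
  toDecomp acc ((false , l) ∷ P) = toDecomp (acc · (end acc , l)) P
  toDecomp acc ((true  , l) ∷ P) = decomp acc (((end acc , l) , U₀ rest) ∷ parts rest)
    where rest = toDecomp (end acc , []) P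

  private
    CyclePieces-after-gap : ∀ acc l P → CyclePieces (endFrom (end acc) l) P →
                            CyclePieces (end (acc · (end acc , l))) P
    CyclePieces-after-gap acc l P = subst (λ v → CyclePieces v P) (sym (end-· acc (end acc , l)))

    CyclePieces-after-cycle : ∀ {v l} P → IsCycle (v , l) → CyclePieces (endFrom v l) P → CyclePieces v P
    CyclePieces-after-cycle P cyc = subst (λ v → CyclePieces v P) (cycle-endFrom cyc)

  start-toDecomp : ∀ acc P → start (U₀ (toDecomp acc P)) ≡ start acc
  start-toDecomp acc []                = refl
  start-toDecomp acc ((false , l) ∷ P) = start-toDecomp (acc · (end acc , l)) P
  start-toDecomp acc ((true  , l) ∷ P) = refl

  toDecomp-wholeNodes : ∀ acc P →
    proj₂ (U₀ (toDecomp acc P)) ++ wholeNodes (parts (toDecomp acc P)) ≡ proj₂ acc ++ pieceNodes P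
  toDecomp-wholeNodes acc []                = refl
  toDecomp-wholeNodes acc ((false , l) ∷ P) =
    trans (toDecomp-wholeNodes (acc · (end acc , l)) P) (++-assoc (proj₂ acc) l (pieceNodes P))
  toDecomp-wholeNodes acc ((true  , l) ∷ P) =
    cong (λ ys → proj₂ acc ++ (l ++ ys)) (toDecomp-wholeNodes (end acc , []) P)

  toDecomp-remNodes : ∀ acc P →
    proj₂ (U₀ (toDecomp acc P)) ++ remNodes (parts (toDecomp acc P)) ≡ proj₂ acc ++ gapNodes P
  toDecomp-remNodes acc []                = refl
  toDecomp-remNodes acc ((false , l) ∷ P) =
    trans (toDecomp-remNodes (acc · (end acc , l)) P) (++-assoc (proj₂ acc) l (gapNodes P))
  toDecomp-remNodes acc ((true  , l) ∷ P) = cong (proj₂ acc ++_) (toDecomp-remNodes (end acc , []) P)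

  lenP-toDecomp : ∀ acc P → lenP (cyclesOf (toDecomp acc P)) ≡ sum (cycleLengths P)
  lenP-toDecomp acc []                = refl
  lenP-toDecomp acc ((false , l) ∷ P) = lenP-toDecomp (acc · (end acc , l)) P
  lenP-toDecomp acc ((true  , l) ∷ P) = cong (length l +_) (lenP-toDecomp (end acc , []) P)

  toDecomp-cycles : ∀ acc P → CyclePieces (end acc) P →
                    All (λ C → IsCycle C × Nonempty C) (cyclesOf (toDecomp acc P))
  toDecomp-cycles acc []                _ = []
  toDecomp-cycles acc ((false , l) ∷ P) c =
    toDecomp-cycles (acc · (end acc , l)) P (CyclePieces-after-gap acc l P c)
  toDecomp-cycles acc ((true  , l) ∷ P) (cyc , c) =
    cyc ∷ toDecomp-cycles (end acc , []) P (CyclePieces-after-cycle P (proj₁ cyc) c)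

  ChainOK-end-irrelevant : ∀ (Q Q′ : Walk N) ps → end Q ≡ end Q′ → ChainOK Q ps → ChainOK Q′ ps
  ChainOK-end-irrelevant Q Q′ []             _  _ = tt
  ChainOK-end-irrelevant Q Q′ ((C , U) ∷ ps) eq (Q→C , QC→U , chain) =
    trans (sym eq) Q→C , trans (sym eqC) QC→U ,
    ChainOK-end-irrelevant ((Q · C) · U) ((Q′ · C) · U) ps eqCU chain
    where
      extend : ∀ (A B X : Walk N) → end A ≡ end B → end (A · X) ≡ end (B · X)
      extend A B X e = trans (end-· A X) (trans (cong (λ v → endFrom v (proj₂ X)) e) (sym (end-· B X)))
      eqC = extend Q Q′ C eq
      eqCU = extend (Q · C) (Q′ · C) U eqC

  toDecomp-chain : ∀ acc P → CyclePieces (end acc) P → ChainOK (U₀ (toDecomp acc P)) (parts (toDecomp acc P))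
  toDecomp-chain acc []                _ = tt
  toDecomp-chain acc ((false , l) ∷ P) c =
    toDecomp-chain (acc · (end acc , l)) P (CyclePieces-after-gap acc l P c)
  toDecomp-chain acc ((true  , l) ∷ P) ((cyc , _) , c) =
    refl , trans end-acc·C (sym (start-toDecomp (e , []) P)) ,
    ChainOK-end-irrelevant (U₀ rest) ((acc · (e , l)) · U₀ rest) (parts rest) end-rest
      (toDecomp-chain (e , []) P (CyclePieces-after-cycle P cyc c))
    where
      e = end acc
      rest = toDecomp (e , []) P
      end-acc·C : end (acc · (e , l)) ≡ e
      end-acc·C = trans (end-· acc (e , l)) (cycle-endFrom cyc)
      end-rest : end (U₀ rest) ≡ end ((acc · (e , l)) · U₀ rest)
      end-rest = trans (cong (λ v → endFrom v (proj₂ (U₀ rest))) (trans (start-toDecomp (e , []) P) (sym end-acc·C)))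
                       (sym (end-· (acc · (e , l)) (U₀ rest)))

  piecesDecomp : Fin N → List (Piece N) → Decomp
  piecesDecomp v = toDecomp (v , [])

  piecesDecomp-DecompOf : ∀ v P → CyclePieces v P →
    DecompOf (piecesDecomp v P) (cyclesOf (piecesDecomp v P)) (v , pieceNodes P)
  piecesDecomp-DecompOf v P c =
    toDecomp-chain (v , []) P c , toDecomp-cycles (v , []) P c , refl ,
    trans (wholeFrom-nodes (U₀ D) (parts D)) (cong₂ _,_ (start-toDecomp (v , []) P) (toDecomp-wholeNodes (v , []) P))
    where D = piecesDecomp v P

  remD-piecesDecomp : ∀ v P → remD (piecesDecomp v P) ≡ (v , gapNodes P)
  remD-piecesDecomp v P =
    trans (remFrom-nodes (U₀ D) (parts D)) (cong₂ _,_ (start-toDecomp (v , []) P) (toDecomp-remNodes (v , []) P))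
    where D = piecesDecomp v P

  pieceNodes-++ : ∀ P Q → pieceNodes (P ++ Q) ≡ pieceNodes P ++ pieceNodes Q
  pieceNodes-++ []            Q = refl
  pieceNodes-++ ((_ , l) ∷ P) Q = trans (cong (l ++_) (pieceNodes-++ P Q)) (sym (++-assoc l _ _))

  gapNodes-++ : ∀ P Q → gapNodes (P ++ Q) ≡ gapNodes P ++ gapNodes Q
  gapNodes-++ []                Q = refl
  gapNodes-++ ((false , l) ∷ P) Q = trans (cong (l ++_) (gapNodes-++ P Q)) (sym (++-assoc l _ _))
  gapNodes-++ ((true  , l) ∷ P) Q = gapNodes-++ P Q

  cycleLengths-++ : ∀ P Q → cycleLengths (P ++ Q) ≡ cycleLengths P ++ cycleLengths Q
  cycleLengths-++ []                Q = refl
  cycleLengths-++ ((false , l) ∷ P) Q = cycleLengths-++ P Q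
  cycleLengths-++ ((true  , l) ∷ P) Q = cong (length l ∷_) (cycleLengths-++ P Q)

  CyclePieces-++ : ∀ v P Q → CyclePieces v P → CyclePieces (endFrom v (pieceNodes P)) Q →
                   CyclePieces v (P ++ Q)
  CyclePieces-++ v []                Q _       c = c
  CyclePieces-++ v ((false , l) ∷ P) Q cP      c =
    CyclePieces-++ _ P Q cP (subst (λ u → CyclePieces u Q) (endFrom-++ v l (pieceNodes P)) c)
  CyclePieces-++ v ((true  , l) ∷ P) Q (x , cP) c =
    x , CyclePieces-++ _ P Q cP (subst (λ u → CyclePieces u Q) (endFrom-++ v l (pieceNodes P)) c)

  cycleLengths-positive : ∀ v P → CyclePieces v P → All (0 <_) (cycleLengths P)
  cycleLengths-positive v []                _               = []
  cycleLengths-positive v ((false , l) ∷ P) c               = cycleLengths-positive _ P c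
  cycleLengths-positive v ((true  , l) ∷ P) ((_ , l≢[]) , c) = l≢[] ∷ cycleLengths-positive _ P c

  endFrom-gapNodes : ∀ v P → CyclePieces v P → endFrom v (gapNodes P) ≡ endFrom v (pieceNodes P)
  endFrom-gapNodes v []                _ = refl
  endFrom-gapNodes v ((false , l) ∷ P) c = begin
    endFrom v (l ++ gapNodes P)               ≡⟨ endFrom-++ v l (gapNodes P) ⟩
    endFrom (endFrom v l) (gapNodes P)        ≡⟨ endFrom-gapNodes _ P c ⟩
    endFrom (endFrom v l) (pieceNodes P)      ≡⟨ endFrom-++ v l (pieceNodes P) ⟨
    endFrom v (l ++ pieceNodes P)             ∎
    where open ≡-Reasoning
  endFrom-gapNodes v ((true  , l) ∷ P) ((cyc , _) , c) = begin
    endFrom v (gapNodes P)                    ≡⟨ endFrom-gapNodes v P (CyclePieces-after-cycle P cyc c) ⟩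
    endFrom v (pieceNodes P)                  ≡⟨ cong (λ u → endFrom u (pieceNodes P)) (cycle-endFrom cyc) ⟨
    endFrom (endFrom v l) (pieceNodes P)      ≡⟨ endFrom-++ v l (pieceNodes P) ⟨
    endFrom v (l ++ pieceNodes P)             ∎
    where open ≡-Reasoning

  -- The i-th marked piece stays a cycle iff the i-th bit of the mask is true (missing bits are false).
  keepCycles : List Bool → List (Piece N) → List (Piece N)
  keepCycles m       []                = []
  keepCycles m       ((false , l) ∷ P) = (false , l) ∷ keepCycles m P
  keepCycles []      ((true  , l) ∷ P) = (false , l) ∷ keepCycles [] P
  keepCycles (b ∷ m) ((true  , l) ∷ P) = (b , l) ∷ keepCycles m P

  pieceNodes-keepCycles : ∀ m P → pieceNodes (keepCycles m P) ≡ pieceNodes P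
  pieceNodes-keepCycles m       []                = refl
  pieceNodes-keepCycles m       ((false , l) ∷ P) = cong (l ++_) (pieceNodes-keepCycles m P)
  pieceNodes-keepCycles []      ((true  , l) ∷ P) = cong (l ++_) (pieceNodes-keepCycles [] P)
  pieceNodes-keepCycles (b ∷ m) ((true  , l) ∷ P) = cong (l ++_) (pieceNodes-keepCycles m P)

  CyclePieces-keepCycles : ∀ m P v → CyclePieces v P → CyclePieces v (keepCycles m P)
  CyclePieces-keepCycles m           []                v _       = tt
  CyclePieces-keepCycles m           ((false , l) ∷ P) v c       = CyclePieces-keepCycles m P _ c
  CyclePieces-keepCycles []          ((true  , l) ∷ P) v (_ , c) = CyclePieces-keepCycles [] P _ c
  CyclePieces-keepCycles (false ∷ m) ((true  , l) ∷ P) v (_ , c) = CyclePieces-keepCycles m P _ c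
  CyclePieces-keepCycles (true  ∷ m) ((true  , l) ∷ P) v (x , c) = x , CyclePieces-keepCycles m P _ c

  sum-cycleLengths-keepCycles : ∀ m P → sum (cycleLengths (keepCycles m P)) ≡ selectedSum m (cycleLengths P)
  sum-cycleLengths-keepCycles []          []                = refl
  sum-cycleLengths-keepCycles (_ ∷ _)     []                = refl
  sum-cycleLengths-keepCycles m           ((false , l) ∷ P) = sum-cycleLengths-keepCycles m P
  sum-cycleLengths-keepCycles []          ((true  , l) ∷ P) = sum-cycleLengths-keepCycles [] P
  sum-cycleLengths-keepCycles (false ∷ m) ((true  , l) ∷ P) = sum-cycleLengths-keepCycles m P
  sum-cycleLengths-keepCycles (true  ∷ m) ((true  , l) ∷ P) = cong (length l +_) (sum-cycleLengths-keepCycles m P)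

  gapNodes-keepCycles⁺ : ∀ {x} m P → x ∈ gapNodes P → x ∈ gapNodes (keepCycles m P)
  gapNodes-keepCycles⁺ m           ((false , l) ∷ P) x∈ with ∈-++⁻ l x∈
  ... | inj₁ x∈l = ∈-++⁺ˡ x∈l
  ... | inj₂ x∈P = ∈-++⁺ʳ l (gapNodes-keepCycles⁺ m P x∈P)
  gapNodes-keepCycles⁺ []          ((true  , l) ∷ P) x∈ = ∈-++⁺ʳ l (gapNodes-keepCycles⁺ [] P x∈)
  gapNodes-keepCycles⁺ (false ∷ m) ((true  , l) ∷ P) x∈ = ∈-++⁺ʳ l (gapNodes-keepCycles⁺ m P x∈)
  gapNodes-keepCycles⁺ (true  ∷ m) ((true  , l) ∷ P) x∈ = gapNodes-keepCycles⁺ m P x∈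

-- Simple cycles

module _ {N : ℕ} where

  open import Data.List.Membership.DecPropositional (_≟ᶠ_ {N}) using (_∈?_)

  Distinct : List (Fin N) → Set
  Distinct []       = ⊤
  Distinct (x ∷ xs) = x ∉ xs × Distinct xs

  count-∉ : ∀ {w : Fin N} xs → w ∉ xs → count w xs ≡ 0
  count-∉ {w} xs w∉ with count w xs in eq
  ... | zero  = refl
  ... | suc _ = ⊥-elim (w∉ (count>0⇒∈ xs (subst (0 <_) (sym eq) (s≤s z≤n))))

  count-Distinct : ∀ (w : Fin N) xs → Distinct xs → count w xs ≤ 1
  count-Distinct w []       _ = z≤n
  count-Distinct w (x ∷ xs) (x∉ , d) with w ≟ᶠ x
  ... | yes refl = s≤s (≤-reflexive (count-∉ xs x∉))
  ... | no  _    = count-Distinct w xs d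

  count-∷ʳ-self : ∀ (w : Fin N) xs → count w (xs ∷ʳ w) ≡ count w xs + 1
  count-∷ʳ-self w xs = trans (count-++ w xs [ w ]) (cong (count w xs +_) count-self)
    where
      count-self : count w [ w ] ≡ 1
      count-self with w ≟ᶠ w
      ... | yes _   = refl
      ... | no  w≢w = ⊥-elim (w≢w refl)

  count-[x]≡1⇒≡ : ∀ {w : Fin N} x → count w [ x ] ≡ 1 → w ≡ x
  count-[x]≡1⇒≡ {w} x eq with w ≟ᶠ x
  ... | yes w≡x = w≡x
  count-[x]≡1⇒≡ x () | no _

  private
    occurs-twice : ∀ a b c {y z} → 2 + (a + (b + c)) ≡ y + z → y ≤ 1 → z ≤ 1 →
                   a ≡ 0 × c ≡ 0 × z ≡ 1
    occurs-twice a b c eq (s≤s z≤n) (s≤s z≤n) =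
      m+n≡0⇒m≡0 a a+b+c≡0 , m+n≡0⇒n≡0 b (m+n≡0⇒n≡0 a a+b+c≡0) , refl
      where a+b+c≡0 = suc-injective (suc-injective eq)
    occurs-twice a b c () z≤n       z≤n
    occurs-twice a b c () z≤n       (s≤s z≤n)
    occurs-twice a b c () (s≤s z≤n) z≤n

  repeat-in-simple-cycle : ∀ {x w : Fin N} b p q r → Distinct (x ∷ b) →
    (x ∷ b) ∷ʳ x ≡ (p ∷ʳ w) ++ ((q ∷ʳ w) ++ r) → w ≡ x × p ≡ [] × r ≡ []
  repeat-in-simple-cycle {x} {w} b p q r distinct eq =
    w≡x , p≡[] p (proj₁ counts) eq , r≡[] r (proj₁ (proj₂ counts)) eq
    where
      c = count w
      counts = occurs-twice (c p) (c q) (c r)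
        (begin
          2 + (c p + (c q + c r))                ≡⟨ regroup (c p) (c q) (c r) ⟩
          (c p + 1) + ((c q + 1) + c r)
            ≡⟨ cong₂ _+_ (sym (count-∷ʳ-self w p)) (cong (_+ c r) (sym (count-∷ʳ-self w q))) ⟩
          c (p ∷ʳ w) + (c (q ∷ʳ w) + c r)        ≡⟨ cong (c (p ∷ʳ w) +_) (sym (count-++ w (q ∷ʳ w) r)) ⟩
          c (p ∷ʳ w) + c ((q ∷ʳ w) ++ r)         ≡⟨ sym (count-++ w (p ∷ʳ w) _) ⟩
          c ((p ∷ʳ w) ++ ((q ∷ʳ w) ++ r))        ≡⟨ cong c (sym eq) ⟩
          c ((x ∷ b) ∷ʳ x)                       ≡⟨ count-++ w (x ∷ b) [ x ] ⟩
          c (x ∷ b) + c [ x ]                    ∎)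
        (count-Distinct w (x ∷ b) distinct) (count-Distinct w [ x ] ((λ ()) , tt))
        where
          open ≡-Reasoning
          regroup : ∀ a b e → 2 + (a + (b + e)) ≡ (a + 1) + ((b + 1) + e)
          regroup = solve 3 (λ a b e → con 2 :+ (a :+ (b :+ e)) := (a :+ con 1) :+ ((b :+ con 1) :+ e)) refl
            where open +-*-Solver
      w≡x = count-[x]≡1⇒≡ x (proj₂ (proj₂ counts))
      p≡[] : ∀ p → c p ≡ 0 → (x ∷ b) ∷ʳ x ≡ (p ∷ʳ w) ++ ((q ∷ʳ w) ++ r) → p ≡ []
      p≡[] []      _     _  = refl
      p≡[] (y ∷ p) cp≡0 eq′ = ⊥-elim (<-irrefl (sym cp≡0)
        (∈⇒count>0 (here (trans w≡x (proj₁ (∷-injective eq′))))))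
      r≡[] : ∀ r → c r ≡ 0 → (x ∷ b) ∷ʳ x ≡ (p ∷ʳ w) ++ ((q ∷ʳ w) ++ r) → r ≡ []
      r≡[] []      _    _   = refl
      r≡[] (y ∷ r) cr≡0 eq′ with r′ , r≡ ← ∷≡∷ʳ-endFrom y r = ⊥-elim (<-irrefl (sym cr≡0)
        (∈⇒count>0 (subst (_∈ y ∷ r) (sym (trans w≡x last≡)) (endFrom-∈ y r))))
        where
          last≡ : x ≡ endFrom y r
          last≡ = proj₂ (∷ʳ-injective (x ∷ b) _ (trans eq′ (trans (cong (λ t → (p ∷ʳ w) ++ ((q ∷ʳ w) ++ t)) r≡)
                    (trans (cong ((p ∷ʳ w) ++_) (sym (++-assoc (q ∷ʳ w) r′ [ endFrom y r ])))
                           (sym (++-assoc (p ∷ʳ w) _ [ endFrom y r ]))))))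

  Distinct⇒IsCycle : ∀ {x : Fin N} b → Distinct (x ∷ b) → IsCycle (x , b ∷ʳ x)
  Distinct⇒IsCycle {x} b distinct = sym (endFrom-++ x b [ x ]) , no-proper-closed-subwalk
    where
      no-proper-closed-subwalk : ∀ X → IsSubwalk X (x , b ∷ʳ x) → X ≢ (x , b ∷ʳ x) →
                                 Closed X → Nonempty X → ⊥
      no-proper-closed-subwalk (w , z ∷ zs) ((u , as) , (_ , bs) , A→X , _ , C≡AXB) X≢C closed _ =
        X≢C (cong₂ _,_ w≡x zs≡)
        where
          open ≡-Reasoning
          x≡u = cong proj₁ C≡AXB
          nodes = cong proj₂ C≡AXB
          init-as = proj₁ (∷≡∷ʳ-endFrom u as)
          u∷as≡ = proj₂ (∷≡∷ʳ-endFrom u as)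
          init-zs = proj₁ (∷≡∷ʳ-endFrom z zs)
          z∷zs≡ = proj₂ (∷≡∷ʳ-endFrom z zs)
          x∷as≡ : x ∷ as ≡ init-as ∷ʳ w
          x∷as≡ = trans (cong (_∷ as) x≡u) (trans u∷as≡ (cong (init-as ∷ʳ_) A→X))
          split : (x ∷ b) ∷ʳ x ≡ (init-as ∷ʳ w) ++ ((init-zs ∷ʳ w) ++ bs)
          split = begin
            x ∷ (b ∷ʳ x)                             ≡⟨ cong (x ∷_) nodes ⟩
            x ∷ ((as ++ z ∷ zs) ++ bs)               ≡⟨ cong (x ∷_) (++-assoc as (z ∷ zs) bs) ⟩
            (x ∷ as) ++ ((z ∷ zs) ++ bs)
              ≡⟨ cong₂ (λ s t → s ++ (t ++ bs)) x∷as≡ (trans z∷zs≡ (cong (init-zs ∷ʳ_) (sym closed))) ⟩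
            (init-as ∷ʳ w) ++ ((init-zs ∷ʳ w) ++ bs) ∎
          repeat = repeat-in-simple-cycle b init-as init-zs bs distinct split
          w≡x = proj₁ repeat
          init-as≡[] = proj₁ (proj₂ repeat)
          bs≡[] = proj₂ (proj₂ repeat)
          as≡[] : as ≡ []
          as≡[] = proj₂ (∷-injective (trans x∷as≡ (cong (_∷ʳ w) init-as≡[])))
          zs≡ : z ∷ zs ≡ b ∷ʳ x
          zs≡ = sym (begin
            b ∷ʳ x                  ≡⟨ nodes ⟩
            (as ++ z ∷ zs) ++ bs    ≡⟨ cong₂ (λ s t → (s ++ z ∷ zs) ++ t) as≡[] bs≡[] ⟩
            (z ∷ zs) ++ []          ≡⟨ ++-identityʳ (z ∷ zs) ⟩
            z ∷ zs                  ∎)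

  Distinct-length : ∀ xs → Distinct xs → length xs ≤ N
  Distinct-length xs distinct with N <? length xs
  ... | no  N≮ = ≮⇒≥ N≮
  ... | yes N< with i , j , i<j , same ← pigeonhole N< (lookup xs) = ⊥-elim (lookup-injective xs distinct i<j same)
    where
      lookup-injective : ∀ xs → Distinct xs → ∀ {i j} → i Fin.< j → lookup xs i ≢ lookup xs j
      lookup-injective (x ∷ xs) (x∉ , _) {Fin.zero}  {Fin.suc j} _         eq = x∉ (subst (_∈ xs) (sym eq) (∈-lookup j))
      lookup-injective (x ∷ xs) (_ , d)  {Fin.suc i} {Fin.suc j} (s≤s i<j) eq = lookup-injective xs d i<j eq

  Distinct-∷ʳ : ∀ xs {x : Fin N} → Distinct xs → x ∉ xs → Distinct (xs ∷ʳ x)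
  Distinct-∷ʳ []       _        _  = (λ ()) , tt
  Distinct-∷ʳ (y ∷ xs) (y∉ , d) x∉ = y∉xs∷ʳx , Distinct-∷ʳ xs d (x∉ ∘ there)
    where
      y∉xs∷ʳx : y ∉ xs ∷ʳ _
      y∉xs∷ʳx y∈ with ∈-++⁻ xs y∈
      ... | inj₁ y∈xs        = y∉ y∈xs
      ... | inj₂ (here refl) = x∉ (here refl)

  Distinct-++⁻ʳ : ∀ xs {ys} → Distinct (xs ++ ys) → Distinct ys
  Distinct-++⁻ʳ []       d       = d
  Distinct-++⁻ʳ (_ ∷ xs) (_ , d) = Distinct-++⁻ʳ xs d

  ∷≡∷ʳ⇒endFrom : ∀ {v e : Fin N} xs ys → v ∷ xs ≡ ys ∷ʳ e → endFrom v xs ≡ e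
  ∷≡∷ʳ⇒endFrom {v} xs ys eq =
    sym (proj₂ (∷ʳ-injective ys _ (trans (sym eq) (proj₂ (∷≡∷ʳ-endFrom v xs)))))

  length-∷ʳ : ∀ {A : Set} (xs : List A) {x} → length (xs ∷ʳ x) ≡ suc (length xs)
  length-∷ʳ xs = trans (length-++ xs) (+-comm (length xs) 1)

  prefix-through : ∀ {v x : Fin N} ys a b → v ∷ ys ≡ a ++ x ∷ b →
                   ∃[ us ] (v ∷ us ≡ a ∷ʳ x × us ++ b ∷ʳ x ≡ ys ∷ʳ x)
  prefix-through ys []      b eq with refl , refl ← ∷-injective eq = [] , refl , refl
  prefix-through {x = x} ys (_ ∷ a) b eq with refl , refl ← ∷-injective eq =
    a ∷ʳ x , refl , trans (++-assoc a [ x ] (b ∷ʳ x)) (sym (++-assoc a (x ∷ b) [ x ]))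

  EarlyCycle : Fin N → List (Fin N) → Set
  EarlyCycle v xs = ∃[ us ] ∃[ cs ] ∃[ rest ]
    (xs ≡ us ++ (cs ++ rest) × length us + length cs ≤ N × IsCycle (endFrom v us , cs) × 0 < length cs)

  -- Walk on until the first repeated node; v ∷ ys are the distinct nodes visited so far.
  earlyCycle-from : ∀ v ys xs → Distinct (v ∷ ys) → N ≤ length ys + length xs → EarlyCycle v (ys ++ xs)
  earlyCycle-from v ys [] distinct N≤ =
    ⊥-elim (<⇒≱ (Distinct-length (v ∷ ys) distinct) (subst (N ≤_) (+-identityʳ (length ys)) N≤))
  earlyCycle-from v ys (x ∷ xs) distinct N≤ with x ∈? v ∷ ys
  ... | no x∉ = subst (EarlyCycle v) (++-assoc ys [ x ] xs)
      (earlyCycle-from v (ys ∷ʳ x) xs (Distinct-∷ʳ (v ∷ ys) distinct x∉)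
        (subst (N ≤_) (trans (+-suc (length ys) (length xs)) (cong (_+ length xs) (sym (length-∷ʳ ys)))) N≤))
  ... | yes x∈ with a , b , v∷ys≡ ← ∈-∃++ x∈ with us , v∷us≡ , us++cs≡ ← prefix-through ys a b v∷ys≡ =
      us , b ∷ʳ x , xs , xs-split , length-ok , cycle , subst (0 <_) (sym (length-∷ʳ b)) (s≤s z≤n)
    where
      xs-split : ys ++ x ∷ xs ≡ us ++ ((b ∷ʳ x) ++ xs)
      xs-split = trans (sym (++-assoc ys [ x ] xs))
                       (trans (cong (_++ xs) (sym us++cs≡)) (++-assoc us (b ∷ʳ x) xs))
      length-ok : length us + length (b ∷ʳ x) ≤ N
      length-ok = subst (_≤ N) (trans (sym (length-∷ʳ ys)) (trans (cong length (sym us++cs≡)) (length-++ us)))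
                        (Distinct-length (v ∷ ys) distinct)
      cycle : IsCycle (endFrom v us , b ∷ʳ x)
      cycle = subst (λ u → IsCycle (u , b ∷ʳ x)) (sym (∷≡∷ʳ⇒endFrom us a v∷us≡))
                (Distinct⇒IsCycle b (Distinct-++⁻ʳ a (subst Distinct v∷ys≡ distinct)))

  -- Each marked cycle with the gap before it has at most N edges, and the last gap fewer than N.
  Chopped : Fin N → List (Fin N) → Set
  Chopped v xs = ∃[ P ] (pieceNodes P ≡ xs × CyclePieces v P × length xs < suc (length (cycleLengths P)) * N)

  chop : ∀ v xs → Chopped v xs
  chop v xs = go (length xs) v xs ≤-refl
    where
      go : ∀ n v xs → length xs ≤ n → Chopped v xs
      go n v xs _ with N ≤? length xs
      ... | no N≰ = (false , xs) ∷ [] , ++-identityʳ xs , tt ,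
                    subst (length xs <_) (sym (+-identityʳ N)) (≰⇒> N≰)
      go zero    v [] _ | yes N≤0 = ⊥-elim (n≮0 (<-≤-trans (toℕ<n v) N≤0))
      go (suc n) v xs ≤n | yes N≤ with earlyCycle-from v [] xs ((λ ()) , tt) N≤
      ... | us , cs , rest , xs≡ , us+cs≤N , cycle , cs≢[] with go n (endFrom (endFrom v us) cs) rest rest≤n
        where
          rest≤n : length rest ≤ n
          rest≤n = ≤-pred (≤-trans (≤-trans (+-monoˡ-≤ (length rest) cs≢[]) (m≤n+m _ (length us)))
                     (subst (_≤ suc n) (trans (cong length xs≡) (trans (length-++ us)
                       (cong (length us +_) (length-++ cs)))) ≤n))
      ... | P , P-nodes , P-cycles , P-bound =
        (false , us) ∷ (true , cs) ∷ P , trans (cong (λ t → us ++ (cs ++ t)) P-nodes) (sym xs≡) ,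
        ((cycle , cs≢[]) , P-cycles) , bound
        where
          length-xs : length xs ≡ (length us + length cs) + length rest
          length-xs = trans (cong length xs≡) (trans (length-++ us) (trans (cong (length us +_) (length-++ cs))
                        (sym (+-assoc (length us) _ _))))
          bound : length xs < suc (suc (length (cycleLengths P))) * N
          bound = subst (_< _) (sym length-xs)
            (≤-trans (s≤s (+-monoˡ-≤ (length rest) us+cs≤N))
              (subst (_≤ N + suc (length (cycleLengths P)) * N) (+-suc N (length rest)) (+-monoʳ-≤ N P-bound)))

  ∈-∷⇒split : ∀ {k v : Fin N} {xs} → k ∈ v ∷ xs → ∃[ as ] ∃[ bs ] (xs ≡ as ++ bs × endFrom v as ≡ k)
  ∈-∷⇒split {xs = xs} (here refl) = [] , xs , refl , refl
  ∈-∷⇒split {k} {v} (there k∈) with ys , zs , refl ← ∈-∃++ k∈ =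
    ys ∷ʳ k , zs , sym (++-assoc ys [ k ] zs) , endFrom-++ v ys [ k ]

  -- Chop the walk on both sides of an occurrence of k, so that k survives the removal of cycles.
  chop-around : ∀ {v k : Fin N} xs → k ∈ v ∷ xs → ∃[ P ]
    (pieceNodes P ≡ xs × CyclePieces v P × k ∈ v ∷ gapNodes P × 2 + length xs ≤ (2 + length (cycleLengths P)) * N)
  chop-around {v} {k} xs k∈ with as , bs , refl , as→k ← ∈-∷⇒split k∈
    with PA , refl , PA-cycles , PA-bound ← chop v as
    with PB , refl , PB-cycles , PB-bound ← chop k bs =
    PA ++ PB , pieceNodes-++ PA PB ,
    CyclePieces-++ v PA PB PA-cycles (subst (λ u → CyclePieces u PB) (sym as→k) PB-cycles) ,
    subst (λ ys → k ∈ v ∷ ys) (sym (gapNodes-++ PA PB))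
      (∈-++⁺ˡ (subst (_∈ v ∷ gapNodes PA) (trans (endFrom-gapNodes v PA PA-cycles) as→k) (endFrom-∈ v (gapNodes PA)))) ,
    bound
    where
      open ≤-Reasoning
      mA = length (cycleLengths PA)
      mB = length (cycleLengths PB)
      bound : 2 + length (pieceNodes PA ++ pieceNodes PB) ≤ (2 + length (cycleLengths (PA ++ PB))) * N
      bound = begin
        2 + length (pieceNodes PA ++ pieceNodes PB)     ≡⟨ cong (2 +_) (length-++ (pieceNodes PA)) ⟩
        2 + (length (pieceNodes PA) + length (pieceNodes PB)) ≡⟨ cong suc (+-suc _ _) ⟨
        suc (length (pieceNodes PA)) + suc (length (pieceNodes PB)) ≤⟨ +-mono-≤ PA-bound PB-bound ⟩
        suc mA * N + suc mB * N                         ≡⟨ *-distribʳ-+ N (suc mA) (suc mB) ⟨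
        (suc mA + suc mB) * N                           ≡⟨ cong (λ m → suc m * N) (+-suc mA mB) ⟩
        (2 + (mA + mB)) * N                             ≡⟨ cong (λ m → (2 + m) * N) cycles-of-both ⟩
        (2 + length (cycleLengths (PA ++ PB))) * N      ∎
        where
          cycles-of-both : mA + mB ≡ length (cycleLengths (PA ++ PB))
          cycles-of-both = trans (sym (length-++ (cycleLengths PA))) (cong length (sym (cycleLengths-++ PA PB)))

-- Long walks admit a nonempty pattern

few-cycles-bound : ∀ {ℓ m d′ N′} → 2 + ℓ ≤ (2 + m) * suc N′ → m ≤ d′ → ℓ ≤ d′ + 2 * suc d′ * N′
few-cycles-bound {ℓ} {m} {d′} {N′} bound m≤d′ = ≤-pred (≤-pred (begin
  2 + ℓ                          ≤⟨ bound ⟩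
  (2 + m) * suc N′               ≤⟨ *-monoˡ-≤ (suc N′) (+-monoʳ-≤ 2 m≤d′) ⟩
  (2 + d′) * suc N′              ≡⟨ *-suc (2 + d′) N′ ⟩
  2 + d′ + (2 + d′) * N′         ≡⟨ +-assoc 2 d′ _ ⟩
  2 + (d′ + (2 + d′) * N′)       ≤⟨ +-monoʳ-≤ 2 (+-monoʳ-≤ d′ (*-monoˡ-≤ N′ 2+d′≤2*[1+d′])) ⟩
  2 + (d′ + 2 * suc d′ * N′)     ∎))
  where
    open ≤-Reasoning
    2+d′≤2*[1+d′] : 2 + d′ ≤ 2 * suc d′
    2+d′≤2*[1+d′] = subst (2 + d′ ≤_) (sym (*-suc 2 d′)) (+-monoʳ-≤ 2 (m≤n*m d′ 2))

module _ {N : ℕ} (dc : DecompChoice {N}) (dc-ok : IsDecompChoice dc) (d : ℕ) (k : Fin N) where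

  selected-pattern : ∀ v P mask → CyclePieces v P → k ∈ v ∷ gapNodes P →
    d ∣ selectedSum mask (cycleLengths P) → 0 < selectedSum mask (cycleLengths P) →
    ∃[ S ] (InS dc d k (v , pieceNodes P) S × 0 < lenP S)
  selected-pattern v P mask cycles k∈ d∣ positive =
    S , (S-pattern , k∈Rem , subst (d ∣_) (sym lenP-S) d∣) , subst (0 <_) (sym lenP-S) positive
    where
      P′ = keepCycles mask P
      D = piecesDecomp v P′
      S = cyclesOf D
      dec : DecompOf D S (v , pieceNodes P)
      dec = subst (DecompOf D S) (cong (v ,_) (pieceNodes-keepCycles mask P))
              (piecesDecomp-DecompOf v P′ (CyclePieces-keepCycles mask P v cycles))
      S-pattern : IsPattern S (v , pieceNodes P)
      S-pattern = D , dec
      lenP-S : lenP S ≡ selectedSum mask (cycleLengths P)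
      lenP-S = trans (lenP-toDecomp (v , []) P′) (sum-cycleLengths-keepCycles mask P)
      keep-gaps : ∀ {u} → u ∈ v ∷ gapNodes P → u ∈ v ∷ gapNodes P′
      keep-gaps (here u≡v)  = here u≡v
      keep-gaps (there u∈P) = there (gapNodes-keepCycles⁺ mask P u∈P)
      k∈Rem : k ∈ₙ Rem dc (v , pieceNodes P) S
      k∈Rem = ∈ₙ-remD-irrelevant dec (dc-ok _ S S-pattern) (subst (k ∈ₙ_) (sym (remD-piecesDecomp v P′)) (keep-gaps k∈))

module _ {N′ : ℕ} (dc : DecompChoice {suc N′}) (dc-ok : IsDecompChoice dc) (d′ : ℕ) (k : Fin (suc N′)) where

  long-walk-shortens : ∀ W → k ∈ₙ W → d′ + 2 * suc d′ * N′ < len W →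
                       ∃[ S ] (InS dc (suc d′) k W S × 0 < lenP S)
  long-walk-shortens (v , xs) k∈ long with P , refl , cycles , k∈gaps , bound ← chop-around xs k∈
    with suc d′ ≤? length (cycleLengths P)
  ... | no few = ⊥-elim (<⇒≱ long (few-cycles-bound bound (≤-pred (≰⇒> few))))
  ... | yes many with mask , d∣ , positive ← divisible-block (suc d′) (cycleLengths P) many (cycleLengths-positive v P cycles) =
    selected-pattern dc dc-ok (suc d′) k v P mask cycles k∈gaps d∣ positive

theorem2 : {N : ℕ} (E : Graph N) (d : ℕ) → 0 < d → (k : Fin N) →
    (dc : DecompChoice) → IsDecompChoice dc →
    (st : Walk N → List (Walk N)) → IsStepChoice E d k dc st →
    (W : Walk N) → IsWalk E W → k ∈ₙ W →
    ∃[ R ] (IsLimitOfIter (Step dc st) W R ×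
            len R ≤ (d ∸ 1) + 2 * d * (N ∸ 1))
theorem2 {suc N′} E (suc d′) _ k dc dc-ok st st-ok W walk k∈
  with R , limit , (walkR , k∈R) , null ← Reduction.Red-exists E (suc d′) k dc dc-ok st st-ok (walk , k∈) =
  R , limit , ≮⇒≥ no-long-reduct
  where
    no-long-reduct : ¬ (d′ + 2 * suc d′ * N′ < len R)
    no-long-reduct long with S , S∈ , S>0 ← long-walk-shortens dc dc-ok d′ k R k∈R long =
      <⇒≱ S>0 (subst (lenP S ≤_) null (proj₂ (st-ok R walkR k∈R) S S∈))
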